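{- Let $r_0,r_1,r_\infty,g_0,g_1,g_\infty\in\mathbb{C}$ with $r_0+r_1+r_\infty=1$ and $g_0+g_1+g_\infty=0$, and let $G_{(r,g)}(t,z)$ denote the exponential generating function of the GKP triangle in the tableau parametrization with pairs $(r_0,g_0)$ at $0$, $(r_1,g_1)$ at $1$, $(r_\infty,g_\infty)$ at $\infty$. Let $(R,S)$ be one of the six pairs $(t,1)$, $(1/t,t)$, $(1-t,-1)$, $(-t/(1-t),1-t)$, $(-(1-t)/t,-t)$, $(1/(1-t),-(1-t))$; the Möbius map $R$ permutes $\{0,1,\infty\}$. Define new parameter pairs $(r^*_q,g^*_q)$, $q\in\{0,1,\infty\}$, by $(r^*_{R^{ -1}(p)},g^*_{R^{ -1}(p)})=(r_p,g_p)$ for each $p\in\{0,1,\infty\}$. Then $G_{(r,g)}(R(t^*),S(t^*)z^*)=G_{(r^*,g^*)}(t^*,z^*)$ in a neighborhood of $(t^*,z^*)=(0,0)$ (with points $t^*=0$ excluded when $R$ has a pole at $0$). That is, each of these six transformations acts by permuting the parameter pairs $(r_0,g_0),(r_1,g_1),(r_\infty,g_\infty)$.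
   Context: For complex parameters $(\alpha,\beta,\gamma;\alpha',\beta',\gamma')$, the GKP triangle is the unique array $T_{n,k}$, $0\le k\le n$ ($T_{n,k}=0$ if $k<0$ or $k>n$), with $T_{0,0}=1$ and $T_{n+1,k+1}=[\alpha n+\beta(k+1)+\gamma]T_{n,k+1}+[\alpha' n+\beta' k+\gamma']T_{n,k}$ for $n\ge0$, $k\ge-1$; its exponential generating function is $\sum_{n,k}T_{n,k}t^kz^n/n!$. The tableau parametrization with pairs $(r_0,g_0),(r_1,g_1),(r_\infty,g_\infty)$ at the points $0,1,\infty$ (where $r_0+r_1+r_\infty=1$, $g_0+g_1+g_\infty=0$) denotes the GKP triangle with $(\alpha,\beta,\gamma;\alpha',\beta',\gamma')=(-r_0,1,g_0;\,1-r_\infty,-1,g_\infty)$. -}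

module Defs where

open import Level using (Level)
open import Data.Nat using (ℕ; zero; suc)
open import Algebra.Bundles using (CommutativeRing)

data Pt : Set where
  p0 p1 p∞ : Pt

-- The six Möbius transformations of the theorem, pairs (R , S):
--   idT  : (t , 1)
--   invT : (1/t , t)
--   oneM : (1-t , -1)
--   mtb  : (-t/(1-t) , 1-t)
--   mbt  : (-(1-t)/t , -t)
--   inv1 : (1/(1-t) , -(1-t))
data Möb : Set where
  idT invT oneM mtb mbt inv1 : Möb

-- The permutation R restricted to {0,1,∞}: act M p = R(p).
act : Möb → Pt → Pt
act idT  p = p
act invT p0 = p∞
act invT p1 = p1
act invT p∞ = p0
act oneM p0 = p1
act oneM p1 = p0
act oneM p∞ = p∞
act mtb  p0 = p0
act mtb  p1 = p∞
act mtb  p∞ = p1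
act mbt  p0 = p∞
act mbt  p1 = p0
act mbt  p∞ = p1
act inv1 p0 = p1
act inv1 p1 = p∞
act inv1 p∞ = p0

-- Sign ε with S = ε · b, when R = a / b (see below).
data Sign : Set where
  plus minus : Sign

sign : Möb → Sign
sign idT  = plus
sign invT = plus
sign oneM = minus
sign mtb  = plus
sign mbt  = minus
sign inv1 = minus

module GKP {c ℓ : Level} (Rg : CommutativeRing c ℓ) where
  open CommutativeRing Rg hiding (zero)

  nat : ℕ → Carrier
  nat zero    = 0#
  nat (suc n) = 1# + nat n

  pow : Carrier → ℕ → Carrier
  pow x zero    = 1#
  pow x (suc n) = x * pow x n

  sumTo : ℕ → (ℕ → Carrier) → Carrier
  sumTo zero    f = f zero
  sumTo (suc n) f = sumTo n f + f (suc n)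

  -- GKP triangle T_{n,k} for parameters (α,β,γ;α',β',γ'), k ≥ 0
  -- (T_{n,-1} = 0 is built in, T_{n,k} = 0 for k > n follows from recursion).
  GKPtri : (α β γ α' β' γ' : Carrier) → ℕ → ℕ → Carrier
  GKPtri α β γ α' β' γ' zero    zero    = 1#
  GKPtri α β γ α' β' γ' zero    (suc k) = 0#
  GKPtri α β γ α' β' γ' (suc n) zero    =
    (α * nat n + γ) * GKPtri α β γ α' β' γ' n zero
  GKPtri α β γ α' β' γ' (suc n) (suc k) =
    (α * nat n + β * nat (suc k) + γ) * GKPtri α β γ α' β' γ' n (suc k)
    + (α' * nat n + β' * nat k + γ') * GKPtri α β γ α' β' γ' n k

  Ttab : (r g : Pt → Carrier) → ℕ → ℕ → Carrier
  Ttab r g = GKPtri (- r p0) 1# (g p0) (1# - r p∞) (- 1#) (g p∞)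

  -- Row polynomial P_n(t) = Σ_k T_{n,k} t^k, so that G(t,z) = Σ_n P_n(t) z^n / n!.
  rowPoly : (r g : Pt → Carrier) → ℕ → Carrier → Carrier
  rowPoly r g n t = sumTo n (λ k → Ttab r g n k * pow t k)

  -- Writing R(t) = num t / den t and S(t) = ε · den t.
  num : Möb → Carrier → Carrier
  num idT  t = t
  num invT t = 1#
  num oneM t = 1# - t
  num mtb  t = - t
  num mbt  t = - (1# - t)
  num inv1 t = 1#

  den : Möb → Carrier → Carrier
  den idT  t = 1#
  den invT t = t
  den oneM t = 1#
  den mtb  t = 1# - t
  den mbt  t = t
  den inv1 t = 1# - t

  signPow : Sign → ℕ → Carrier
  signPow plus  n = 1#
  signPow minus n = pow (- 1#) n

  -- Coefficient of z^n/n! in G_{(r,g)}(R(t), S(t) z), i.e. P_n(R(t)) S(t)^n,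
  -- written as the polynomial ε^n Σ_k T_{n,k} num(t)^k den(t)^(n-k).
  transformedRow : Möb → (r g : Pt → Carrier) → ℕ → Carrier → Carrier
  transformedRow M r g n t =
    signPow (sign M) n *
    sumTo n (λ k → Ttab r g n k * pow (num M t) k * pow (den M t) (n Data.Nat.∸ k))

{-# OPTIONS --safe #-}
-- With β = 1 and β′ = -1 the GKP recursion, written for the homogenised row polynomials
-- P n (X , Y) = Σ_k T n k X^k Y^(n-k), reads
--   P (n+1) = (A n · Y + B n · X) · P n + (Y - X) · X ∂_X (P n),
-- with A n, B n affine in n. The claim (±1)^n P n (num t , den t) = P* n (t , 1) is proved by
-- induction on n, simultaneously for all commutative rings. The inductive step also needs
-- the claim for the X-derivative; it is obtained from the induction hypothesis in the ring
-- of dual numbers R[ε] at the point t + ε t(1 - t). The vector field t(1 - t) d/dt vanishes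
-- at 0 and 1, so each of the six maps carries it to a polynomial multiple of itself; what is
-- left is one ring identity per map, where the relations Σ r = 1 and Σ g = 0 enter.
module Submission where

open import Defs
open import Level using (Level; _⊔_) renaming (suc to lsuc)
open import Algebra.Bundles using (CommutativeRing)
open import Data.Integer.Base as ℤ using (ℤ; +_; -[1+_]; _⊖_; +-*-rawRing)
import Data.Integer.Properties as ℤ
open import Data.Maybe.Base as Maybe using ()
open import Data.Nat.Base as ℕ using (ℕ; zero; suc)
import Data.Nat.Properties as ℕ
open import Data.Sign.Base as Sign using ()
open import Relation.Binary.Consequences using (dec⇒weaklyDec)
open import Relation.Binary.PropositionalEquality using (_≡_; cong)
open import Data.Product.Base using (_,_; proj₂)
import Algebra.Module.Construct.Idealization as Idealization
import Algebra.Module.Construct.TensorUnit as TensorUnit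
open import Algebra.Solver.Ring.AlmostCommutativeRing
  using (fromCommutativeRing; _-Raw-AlmostCommutative⟶_)

-- The ring solvers over an abstract ring use its own elements as coefficients and cannot
-- cancel x - x; we instantiate the solver with integer coefficients instead. The optimised
-- multiplication _×_ makes ⟦ + 1 ⟧ℤ reduce to 1#, so that :1 matches 1# on the nose.
module ℤ-CoefficientSolver {c ℓ : Level} (R : CommutativeRing c ℓ) where
  open CommutativeRing R hiding (zero)
  open import Algebra.Properties.Ring ring using (-0#≈0#; -‿involutive; -‿distribˡ-*; -‿distribʳ-*; -‿+-comm)
  open import Algebra.Properties.CommutativeSemigroup +-commutativeSemigroup using (interchange)
  open import Algebra.Properties.Semiring.Mult.TCOptimised semiring using (_×_; 1+×; ×-homo-+; ×1-homo-*)
  open import Relation.Binary.Reasoning.Setoid setoid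

  ⟦_⟧ℤ : ℤ → Carrier
  ⟦ + n ⟧ℤ = n × 1#
  ⟦ -[1+ n ] ⟧ℤ = - (suc n × 1#)

  ⊖-homo : ∀ m n → ⟦ m ⊖ n ⟧ℤ ≈ m × 1# - n × 1#
  ⊖-homo m zero = sym (trans (+-congˡ -0#≈0#) (+-identityʳ _))
  ⊖-homo zero (suc n) = sym (+-identityˡ _)
  ⊖-homo (suc m) (suc n) rewrite ℤ.[1+m]⊖[1+n]≡m⊖n m n = begin
    ⟦ m ⊖ n ⟧ℤ                          ≈⟨ ⊖-homo m n ⟩
    m × 1# - n × 1#                     ≈⟨ +-identityˡ _ ⟨
    0# + (m × 1# - n × 1#)              ≈⟨ +-congʳ (-‿inverseʳ 1#) ⟨
    (1# - 1#) + (m × 1# - n × 1#)       ≈⟨ interchange 1# (- 1#) (m × 1#) (- (n × 1#)) ⟩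
    (1# + m × 1#) + (- 1# - n × 1#)     ≈⟨ +-congˡ (-‿+-comm 1# (n × 1#)) ⟩
    (1# + m × 1#) - (1# + n × 1#)       ≈⟨ +-cong (1+× m 1#) (-‿cong (1+× n 1#)) ⟨
    suc m × 1# - suc n × 1#             ∎

  +-homo : ∀ i j → ⟦ i ℤ.+ j ⟧ℤ ≈ ⟦ i ⟧ℤ + ⟦ j ⟧ℤ
  +-homo (+ m) (+ n) = ×-homo-+ 1# m n
  +-homo (+ m) -[1+ n ] = ⊖-homo m (suc n)
  +-homo -[1+ m ] (+ n) = trans (⊖-homo n (suc m)) (+-comm _ _)
  +-homo -[1+ m ] -[1+ n ] = begin
    - (suc (suc (m ℕ.+ n)) × 1#)          ≡⟨ cong (λ k → - (suc k × 1#)) (ℕ.+-suc m n) ⟨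
    - ((suc m ℕ.+ suc n) × 1#)            ≈⟨ -‿cong (×-homo-+ 1# (suc m) (suc n)) ⟩
    - (suc m × 1# + suc n × 1#)           ≈⟨ -‿+-comm _ _ ⟨
    - (suc m × 1#) + - (suc n × 1#)       ∎

  +◃-homo : ∀ n → ⟦ Sign.+ ℤ.◃ n ⟧ℤ ≈ n × 1#
  +◃-homo zero = refl
  +◃-homo (suc n) = refl

  -◃-homo : ∀ n → ⟦ Sign.- ℤ.◃ n ⟧ℤ ≈ - (n × 1#)
  -◃-homo zero = sym -0#≈0#
  -◃-homo (suc n) = refl

  *-homo : ∀ i j → ⟦ i ℤ.* j ⟧ℤ ≈ ⟦ i ⟧ℤ * ⟦ j ⟧ℤ
  *-homo (+ m) (+ n) = trans (+◃-homo (m ℕ.* n)) (×1-homo-* m n)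
  *-homo (+ m) -[1+ n ] = begin
    ⟦ Sign.- ℤ.◃ (m ℕ.* suc n) ⟧ℤ    ≈⟨ -◃-homo (m ℕ.* suc n) ⟩
    - ((m ℕ.* suc n) × 1#)           ≈⟨ -‿cong (×1-homo-* m (suc n)) ⟩
    - (m × 1# * suc n × 1#)          ≈⟨ -‿distribʳ-* _ _ ⟩
    m × 1# * - (suc n × 1#)          ∎
  *-homo -[1+ m ] (+ n) = begin
    ⟦ Sign.- ℤ.◃ (suc m ℕ.* n) ⟧ℤ    ≈⟨ -◃-homo (suc m ℕ.* n) ⟩
    - ((suc m ℕ.* n) × 1#)           ≈⟨ -‿cong (×1-homo-* (suc m) n) ⟩
    - (suc m × 1# * n × 1#)          ≈⟨ -‿distribˡ-* _ _ ⟩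
    - (suc m × 1#) * n × 1#          ∎
  *-homo -[1+ m ] -[1+ n ] = begin
    ⟦ Sign.+ ℤ.◃ (suc m ℕ.* suc n) ⟧ℤ       ≈⟨ +◃-homo (suc m ℕ.* suc n) ⟩
    (suc m ℕ.* suc n) × 1#                  ≈⟨ ×1-homo-* (suc m) (suc n) ⟩
    suc m × 1# * suc n × 1#                 ≈⟨ -‿involutive _ ⟨
    - - (suc m × 1# * suc n × 1#)           ≈⟨ -‿cong (-‿distribˡ-* _ _) ⟩
    - (- (suc m × 1#) * suc n × 1#)         ≈⟨ -‿distribʳ-* _ _ ⟩
    - (suc m × 1#) * - (suc n × 1#)         ∎

  -‿homo : ∀ i → ⟦ ℤ.- i ⟧ℤ ≈ - ⟦ i ⟧ℤ
  -‿homo (+ zero) = sym -0#≈0#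
  -‿homo (+ suc n) = refl
  -‿homo -[1+ n ] = sym (-‿involutive _)

  homomorphism : +-*-rawRing -Raw-AlmostCommutative⟶ fromCommutativeRing R
  homomorphism = record
    { ⟦_⟧ = ⟦_⟧ℤ ; +-homo = +-homo ; *-homo = *-homo ; -‿homo = -‿homo
    ; 0-homo = refl ; 1-homo = refl }

  open import Algebra.Solver.Ring +-*-rawRing (fromCommutativeRing R) homomorphism
    (λ i j → Maybe.map (λ i≡j → reflexive (cong ⟦_⟧ℤ i≡j)) (dec⇒weaklyDec ℤ._≟_ i j)) public

  :0 :1 : ∀ {m} → Polynomial m
  :0 = con (+ 0)
  :1 = con (+ 1)

module BinaryForms {c ℓ : Level} (R : CommutativeRing c ℓ) where
  open CommutativeRing R hiding (zero)
  open GKP R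
  open ℤ-CoefficientSolver R using (solve; _:=_; :0; :1; _:+_; _:*_; _:-_)
  open import Relation.Binary.Reasoning.Setoid setoid

  nat-+ : ∀ m n → nat (m ℕ.+ n) ≈ nat m + nat n
  nat-+ zero n = sym (+-identityˡ _)
  nat-+ (suc m) n = trans (+-congˡ (nat-+ m n)) (sym (+-assoc _ _ _))

  nat-∸ : ∀ {n k} → k ℕ.≤ n → nat (n ℕ.∸ k) ≈ nat n - nat k
  nat-∸ {n} {k} k≤n = begin
    nat (n ℕ.∸ k)                  ≈⟨ solve 2 (λ d k → d := d :+ k :- k) refl (nat (n ℕ.∸ k)) (nat k) ⟩
    nat (n ℕ.∸ k) + nat k - nat k  ≈⟨ +-congʳ (nat-+ (n ℕ.∸ k) k) ⟨
    nat (n ℕ.∸ k ℕ.+ k) - nat k    ≡⟨ cong (λ m → nat m - nat k) (ℕ.m∸n+n≡m k≤n) ⟩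
    nat n - nat k                  ∎

  pow-1# : ∀ k → pow 1# k ≈ 1#
  pow-1# zero = refl
  pow-1# (suc k) = trans (*-identityˡ _) (pow-1# k)

  pow′ : Carrier → ℕ → Carrier
  pow′ x zero = 0#
  pow′ x (suc k) = pow x k + x * pow′ x k

  *-pow′ : ∀ x k → x * pow′ x k ≈ nat k * pow x k
  *-pow′ x zero = trans (zeroʳ x) (sym (zeroˡ 1#))
  *-pow′ x (suc k) = begin
    x * (pow x k + x * pow′ x k)   ≈⟨ *-congˡ (+-congˡ (*-pow′ x k)) ⟩
    x * (pow x k + nat k * pow x k)
      ≈⟨ solve 3 (λ x p m → x :* (p :+ m :* p) := (:1 :+ m) :* (x :* p)) refl x (pow x k) (nat k) ⟩
    (1# + nat k) * (x * pow x k)   ∎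

  sumTo-cong : ∀ n {f g : ℕ → Carrier} → (∀ k → k ℕ.≤ n → f k ≈ g k) → sumTo n f ≈ sumTo n g
  sumTo-cong zero f≈g = f≈g 0 ℕ.z≤n
  sumTo-cong (suc n) f≈g = +-cong (sumTo-cong n (λ k k≤n → f≈g k (ℕ.m≤n⇒m≤1+n k≤n))) (f≈g (suc n) ℕ.≤-refl)

  sumTo-+ : ∀ n (f g : ℕ → Carrier) → sumTo n (λ k → f k + g k) ≈ sumTo n f + sumTo n g
  sumTo-+ zero f g = refl
  sumTo-+ (suc n) f g = trans (+-congʳ (sumTo-+ n f g)) (interchange _ _ _ _)
    where open import Algebra.Properties.CommutativeSemigroup +-commutativeSemigroup using (interchange)

  *-distribˡ-sumTo : ∀ n x (f : ℕ → Carrier) → sumTo n (λ k → x * f k) ≈ x * sumTo n f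
  *-distribˡ-sumTo zero x f = refl
  *-distribˡ-sumTo (suc n) x f = trans (+-congʳ (*-distribˡ-sumTo n x f)) (sym (distribˡ _ _ _))

  sumTo-suc : ∀ n (f : ℕ → Carrier) → sumTo (suc n) f ≈ f 0 + sumTo n (λ k → f (suc k))
  sumTo-suc zero f = refl
  sumTo-suc (suc n) f = trans (+-congʳ (sumTo-suc n f)) (+-assoc _ _ _)

  monomial : ℕ → (ℕ → Carrier) → Carrier → Carrier → ℕ → Carrier
  monomial n a X Y k = a k * pow X k * pow Y (n ℕ.∸ k)

  binaryForm : ℕ → (ℕ → Carrier) → Carrier → Carrier → Carrier
  binaryForm n a X Y = sumTo n (monomial n a X Y)

  eulerForm : ℕ → (ℕ → Carrier) → Carrier → Carrier → Carrier
  eulerForm n a X Y = sumTo n (λ k → nat k * monomial n a X Y k)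

  binaryForm-cong : ∀ n {a b : ℕ → Carrier} X Y → (∀ k → a k ≈ b k) → binaryForm n a X Y ≈ binaryForm n b X Y
  binaryForm-cong n X Y a≈b = sumTo-cong n (λ k _ → *-congʳ (*-congʳ (a≈b k)))

  binaryForm-+ : ∀ n (a b : ℕ → Carrier) X Y →
                 binaryForm n (λ k → a k + b k) X Y ≈ binaryForm n a X Y + binaryForm n b X Y
  binaryForm-+ n a b X Y = begin
    binaryForm n (λ k → a k + b k) X Y
      ≈⟨ sumTo-cong n (λ k _ → trans (*-congʳ (distribʳ _ _ _)) (distribʳ _ _ _)) ⟩
    sumTo n (λ k → monomial n a X Y k + monomial n b X Y k)
      ≈⟨ sumTo-+ n _ _ ⟩
    binaryForm n a X Y + binaryForm n b X Y ∎

  binaryForm-affine : ∀ n A β (a : ℕ → Carrier) X Y →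
                      binaryForm n (λ k → (A + β * nat k) * a k) X Y ≈ A * binaryForm n a X Y + β * eulerForm n a X Y
  binaryForm-affine n A β a X Y = begin
    binaryForm n (λ k → (A + β * nat k) * a k) X Y
      ≈⟨ sumTo-cong n (λ k _ → solve 6 (λ A β m a x y → (A :+ β :* m) :* a :* x :* y
                                                     := A :* (a :* x :* y) :+ β :* (m :* (a :* x :* y)))
                                   refl A β (nat k) (a k) (pow X k) (pow Y (n ℕ.∸ k))) ⟩
    sumTo n (λ k → A * monomial n a X Y k + β * (nat k * monomial n a X Y k))
      ≈⟨ sumTo-+ n _ _ ⟩
    sumTo n (λ k → A * monomial n a X Y k) + sumTo n (λ k → β * (nat k * monomial n a X Y k))
      ≈⟨ +-cong (*-distribˡ-sumTo n A _) (*-distribˡ-sumTo n β _) ⟩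
    A * binaryForm n a X Y + β * eulerForm n a X Y ∎

  binaryForm-raise : ∀ n (a : ℕ → Carrier) X Y → a (suc n) ≈ 0# → binaryForm (suc n) a X Y ≈ Y * binaryForm n a X Y
  binaryForm-raise n a X Y a[n+1]≈0 = begin
    sumTo n (λ k → a k * pow X k * pow Y (suc n ℕ.∸ k)) + a (suc n) * pow X (suc n) * pow Y (n ℕ.∸ n)
      ≈⟨ +-cong (sumTo-cong n raise) (trans (*-congʳ (*-congʳ a[n+1]≈0)) (trans (*-congʳ (zeroˡ _)) (zeroˡ _))) ⟩
    sumTo n (λ k → Y * monomial n a X Y k) + 0#  ≈⟨ +-identityʳ _ ⟩
    sumTo n (λ k → Y * monomial n a X Y k)       ≈⟨ *-distribˡ-sumTo n Y _ ⟩
    Y * binaryForm n a X Y ∎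
    where
    raise : ∀ k → k ℕ.≤ n → a k * pow X k * pow Y (suc n ℕ.∸ k) ≈ Y * monomial n a X Y k
    raise k k≤n rewrite ℕ.+-∸-assoc 1 k≤n =
      solve 4 (λ a x y p → a :* x :* (y :* p) := y :* (a :* x :* p)) refl (a k) (pow X k) Y (pow Y (n ℕ.∸ k))

  shiftʳ : (ℕ → Carrier) → ℕ → Carrier
  shiftʳ a zero = 0#
  shiftʳ a (suc k) = a k

  binaryForm-shiftʳ : ∀ n (a : ℕ → Carrier) X Y → binaryForm (suc n) (shiftʳ a) X Y ≈ X * binaryForm n a X Y
  binaryForm-shiftʳ n a X Y = begin
    binaryForm (suc n) (shiftʳ a) X Y                       ≈⟨ sumTo-suc n _ ⟩
    0# * 1# * pow Y (suc n) + sumTo n (λ k → a k * (X * pow X k) * pow Y (n ℕ.∸ k))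
      ≈⟨ +-cong (trans (*-congʳ (zeroˡ _)) (zeroˡ _))
                (sumTo-cong n (λ k _ → solve 4 (λ a x p q → a :* (x :* p) :* q := x :* (a :* p :* q))
                                               refl (a k) X (pow X k) (pow Y (n ℕ.∸ k)))) ⟩
    0# + sumTo n (λ k → X * monomial n a X Y k)  ≈⟨ +-identityˡ _ ⟩
    sumTo n (λ k → X * monomial n a X Y k)       ≈⟨ *-distribˡ-sumTo n X _ ⟩
    X * binaryForm n a X Y ∎

  binaryForm-at-1# : ∀ n (a : ℕ → Carrier) X → binaryForm n a X 1# ≈ sumTo n (λ k → a k * pow X k)
  binaryForm-at-1# n a X = sumTo-cong n (λ k _ → trans (*-congˡ (pow-1# (n ℕ.∸ k))) (*-identityʳ _))

  module _ (α β γ α′ β′ γ′ : Carrier) where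
    private
      T : ℕ → ℕ → Carrier
      T = GKPtri α β γ α′ β′ γ′

    GKPtri-upper : ∀ {n k} → n ℕ.< k → T n k ≈ 0#
    GKPtri-upper {zero} {suc k} _ = refl
    GKPtri-upper {suc n} {suc k} (ℕ.s≤s n<k) = begin
      _ * T n (suc k) + _ * T n k   ≈⟨ +-cong (*-congˡ (GKPtri-upper (ℕ.m<n⇒m<1+n n<k))) (*-congˡ (GKPtri-upper n<k)) ⟩
      _ * 0# + _ * 0#               ≈⟨ +-cong (zeroʳ _) (zeroʳ _) ⟩
      0# + 0#                       ≈⟨ +-identityʳ 0# ⟩
      0#                            ∎

    GKPtri-suc : ∀ n k → T (suc n) k ≈
      (α * nat n + γ + β * nat k) * T n k + shiftʳ (λ j → (α′ * nat n + γ′ + β′ * nat j) * T n j) k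
    GKPtri-suc n zero =
      solve 5 (λ a m g b t → (a :* m :+ g) :* t := (a :* m :+ g :+ b :* :0) :* t :+ :0) refl α (nat n) γ β (T n 0)
    GKPtri-suc n (suc k) =
      solve 10 (λ a m g b k t a′ g′ b′ t′ → (a :* m :+ b :* (:1 :+ k) :+ g) :* t :+ (a′ :* m :+ b′ :* k :+ g′) :* t′
                                          := (a :* m :+ g :+ b :* (:1 :+ k)) :* t :+ (a′ :* m :+ g′ :+ b′ :* k) :* t′)
        refl α (nat n) γ β (nat k) (T n (suc k)) α′ γ′ β′ (T n k)

    binaryForm-GKPtri-suc : ∀ n X Y →
      binaryForm (suc n) (T (suc n)) X Y ≈
        Y * ((α * nat n + γ) * binaryForm n (T n) X Y + β * eulerForm n (T n) X Y) +
        X * ((α′ * nat n + γ′) * binaryForm n (T n) X Y + β′ * eulerForm n (T n) X Y)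
    binaryForm-GKPtri-suc n X Y = begin
      binaryForm (suc n) (T (suc n)) X Y
        ≈⟨ binaryForm-cong (suc n) X Y (GKPtri-suc n) ⟩
      binaryForm (suc n) (λ k → upper k + shiftʳ lower k) X Y
        ≈⟨ binaryForm-+ (suc n) upper (shiftʳ lower) X Y ⟩
      binaryForm (suc n) upper X Y + binaryForm (suc n) (shiftʳ lower) X Y
        ≈⟨ +-cong (binaryForm-raise n upper X Y upper-top) (binaryForm-shiftʳ n lower X Y) ⟩
      Y * binaryForm n upper X Y + X * binaryForm n lower X Y
        ≈⟨ +-cong (*-congˡ (binaryForm-affine n _ β (T n) X Y)) (*-congˡ (binaryForm-affine n _ β′ (T n) X Y)) ⟩
      _ ∎
      where
      upper lower : ℕ → Carrier
      upper k = (α * nat n + γ + β * nat k) * T n k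
      lower j = (α′ * nat n + γ′ + β′ * nat j) * T n j
      upper-top : upper (suc n) ≈ 0#
      upper-top = trans (*-congˡ (GKPtri-upper {n} ℕ.≤-refl)) (zeroʳ _)

-- R[ε] with ε² = 0, as Nagata's idealization R ⋉ R of R as a module over itself.
dualNumbers : ∀ {c ℓ} → CommutativeRing c ℓ → CommutativeRing c ℓ
dualNumbers R = record
  { isCommutativeRing = record
    { isRing = isRingᴺ
    ; *-comm = λ (a , a′) (b , b′) → *-comm a b , trans (+-comm _ _) (+-cong (*-comm a′ b) (*-comm a b′))
    }
  }
  where
  open CommutativeRing R hiding (zero)
  open Idealization ring TensorUnit.bimodule using (isRingᴺ)

module DualNumbers {c ℓ : Level} (R : CommutativeRing c ℓ) where
  open CommutativeRing R hiding (zero)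
  open GKP R
  open BinaryForms R
  open ℤ-CoefficientSolver R using (solve; _:=_; :0; _:+_; _:*_; _:-_)
  open import Algebra.Properties.Ring ring using (-0#≈0#)
  open import Relation.Binary.Reasoning.Setoid setoid

  module Dual = CommutativeRing (dualNumbers R)
  module DualGKP = GKP (dualNumbers R)
  module DualForms = BinaryForms (dualNumbers R)
  open Dual public using () renaming (_≈_ to _≈ᴰ_; _+_ to _+ᴰ_; _*_ to _*ᴰ_)

  ι : Carrier → Dual.Carrier
  ι x = x , 0#

  ι-+ : ∀ {x̂ ŷ x y} → x̂ ≈ᴰ ι x → ŷ ≈ᴰ ι y → x̂ +ᴰ ŷ ≈ᴰ ι (x + y)
  ι-+ x̂≈ ŷ≈ = Dual.trans (Dual.+-cong x̂≈ ŷ≈) (refl , +-identityˡ 0#)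

  ι-* : ∀ {x̂ ŷ x y} → x̂ ≈ᴰ ι x → ŷ ≈ᴰ ι y → x̂ *ᴰ ŷ ≈ᴰ ι (x * y)
  ι-* {x = x} {y} x̂≈ ŷ≈ = Dual.trans (Dual.*-cong x̂≈ ŷ≈) (refl , trans (+-cong (zeroʳ x) (zeroˡ y)) (+-identityˡ 0#))

  ι-nat : ∀ k → DualGKP.nat k ≈ᴰ ι (nat k)
  ι-nat zero = Dual.refl
  ι-nat (suc k) = ι-+ Dual.refl (ι-nat k)

  ι-GKPtri : ∀ {α̂ β̂ γ̂ α̂′ β̂′ γ̂′ α β γ α′ β′ γ′} →
             α̂ ≈ᴰ ι α → β̂ ≈ᴰ ι β → γ̂ ≈ᴰ ι γ → α̂′ ≈ᴰ ι α′ → β̂′ ≈ᴰ ι β′ → γ̂′ ≈ᴰ ι γ′ →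
             ∀ n k → DualGKP.GKPtri α̂ β̂ γ̂ α̂′ β̂′ γ̂′ n k ≈ᴰ ι (GKPtri α β γ α′ β′ γ′ n k)
  ι-GKPtri hα hβ hγ hα′ hβ′ hγ′ = go
    where
    go : ∀ n k → DualGKP.GKPtri _ _ _ _ _ _ n k ≈ᴰ ι (GKPtri _ _ _ _ _ _ n k)
    go zero zero = Dual.refl
    go zero (suc k) = Dual.refl
    go (suc n) zero = ι-* (ι-+ (ι-* hα (ι-nat n)) hγ) (go n zero)
    go (suc n) (suc k) =
      ι-+ (ι-* (ι-+ (ι-+ (ι-* hα (ι-nat n)) (ι-* hβ (ι-nat (suc k)))) hγ) (go n (suc k)))
          (ι-* (ι-+ (ι-+ (ι-* hα′ (ι-nat n)) (ι-* hβ′ (ι-nat k))) hγ′) (go n k))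

  ι-pow : ∀ {x̂ x} → x̂ ≈ᴰ ι x → ∀ k → DualGKP.pow x̂ k ≈ᴰ ι (pow x k)
  ι-pow x̂≈ zero = Dual.refl
  ι-pow x̂≈ (suc k) = ι-* x̂≈ (ι-pow x̂≈ k)

  ι-signPow : ∀ s n → DualGKP.signPow s n ≈ᴰ ι (signPow s n)
  ι-signPow plus n = Dual.refl
  ι-signPow minus n = ι-pow (refl , -0#≈0#) n

  ι-Ttab : ∀ (r g : Pt → Carrier) n k → DualGKP.Ttab (λ q → ι (r q)) (λ q → ι (g q)) n k ≈ᴰ ι (Ttab r g n k)
  ι-Ttab r g = ι-GKPtri (refl , -0#≈0#) Dual.refl Dual.refl
                        (refl , trans (+-identityˡ _) -0#≈0#) (refl , -0#≈0#) Dual.refl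

  pow-dual : ∀ {x X P} → x ≈ᴰ (X , P) → ∀ k → DualGKP.pow x k ≈ᴰ (pow X k , pow′ X k * P)
  pow-dual x≈ zero = refl , sym (zeroˡ _)
  pow-dual {X = X} {P} x≈ (suc k) = Dual.trans (Dual.*-cong x≈ (pow-dual x≈ k))
    (refl , solve 4 (λ x p q d → x :* (d :* p) :+ p :* q := (q :+ x :* d) :* p) refl X P (pow X k) (pow′ X k))

  proj₂-ι-* : ∀ {x̂ x} ŷ → x̂ ≈ᴰ ι x → proj₂ (x̂ *ᴰ ŷ) ≈ x * proj₂ ŷ
  proj₂-ι-* ŷ (x̂₁≈x , x̂₂≈0) = trans (+-cong (*-congʳ x̂₁≈x) (trans (*-congʳ x̂₂≈0) (zeroˡ _))) (+-identityʳ _)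

  proj₂-sumTo : ∀ n (F : ℕ → Dual.Carrier) → proj₂ (DualGKP.sumTo n F) ≡ sumTo n (λ k → proj₂ (F k))
  proj₂-sumTo zero F = _≡_.refl
  proj₂-sumTo (suc n) F = cong (_+ proj₂ (F (suc n))) (proj₂-sumTo n F)

  proj₂-binaryForm : ∀ n {b : ℕ → Dual.Carrier} {x y} (a : ℕ → Carrier) X Y u v →
                     (∀ k → b k ≈ᴰ ι (a k)) → x ≈ᴰ (X , X * u) → y ≈ᴰ (Y , Y * v) →
                     proj₂ (DualForms.binaryForm n b x y) ≈ (u - v) * eulerForm n a X Y + v * nat n * binaryForm n a X Y
  proj₂-binaryForm n {b} {x} {y} a X Y u v b≈ x≈ y≈ = begin
    proj₂ (DualForms.binaryForm n b x y)   ≡⟨ proj₂-sumTo n _ ⟩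
    sumTo n (λ k → proj₂ (b k *ᴰ DualGKP.pow x k *ᴰ DualGKP.pow y (n ℕ.∸ k)))
      ≈⟨ sumTo-cong n term ⟩
    sumTo n (λ k → (u - v) * (nat k * μ k) + v * nat n * μ k)
      ≈⟨ sumTo-+ n _ _ ⟩
    sumTo n (λ k → (u - v) * (nat k * μ k)) + sumTo n (λ k → v * nat n * μ k)
      ≈⟨ +-cong (*-distribˡ-sumTo n (u - v) _) (*-distribˡ-sumTo n (v * nat n) μ) ⟩
    (u - v) * eulerForm n a X Y + v * nat n * binaryForm n a X Y ∎
    where
    μ : ℕ → Carrier
    μ = monomial n a X Y
    term : ∀ k → k ℕ.≤ n →
           proj₂ (b k *ᴰ DualGKP.pow x k *ᴰ DualGKP.pow y (n ℕ.∸ k)) ≈ (u - v) * (nat k * μ k) + v * nat n * μ k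
    term k k≤n = begin
      proj₂ (b k *ᴰ DualGKP.pow x k *ᴰ DualGKP.pow y m)
        ≈⟨ proj₂ (Dual.*-cong (Dual.*-cong (b≈ k) (pow-dual x≈ k)) (pow-dual y≈ m)) ⟩
      a k * pow X k * (pow′ Y m * (Y * v)) + (a k * (pow′ X k * (X * u)) + 0# * pow X k) * pow Y m
        ≈⟨ solve 9 (λ a xk dy y v dx x u ym →
                      a :* xk :* (dy :* (y :* v)) :+ (a :* (dx :* (x :* u)) :+ :0 :* xk) :* ym
                      := v :* (a :* xk :* (y :* dy)) :+ u :* (a :* (x :* dx) :* ym))
             refl (a k) (pow X k) (pow′ Y m) Y v (pow′ X k) X u (pow Y m) ⟩
      v * (a k * pow X k * (Y * pow′ Y m)) + u * (a k * (X * pow′ X k) * pow Y m)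
        ≈⟨ +-cong (*-congˡ (*-congˡ (trans (*-pow′ Y m) (*-congʳ (nat-∸ k≤n)))))
                  (*-congˡ (*-congʳ (*-congˡ (*-pow′ X k)))) ⟩
      v * (a k * pow X k * ((nat n - nat k) * pow Y m)) + u * (a k * (nat k * pow X k) * pow Y m)
        ≈⟨ solve 7 (λ v a xk nn nk ym u → v :* (a :* xk :* ((nn :- nk) :* ym)) :+ u :* (a :* (nk :* xk) :* ym)
                                         := (u :- v) :* (nk :* (a :* xk :* ym)) :+ v :* nn :* (a :* xk :* ym))
             refl v (a k) (pow X k) (nat n) (nat k) (pow Y m) u ⟩
      (u - v) * (nat k * μ k) + v * nat n * μ k ∎
      where
      m : ℕ
      m = n ℕ.∸ k

module Möbius {c ℓ : Level} (R : CommutativeRing c ℓ) where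
  open CommutativeRing R hiding (zero)
  open GKP R
  open DualNumbers R using (module DualGKP; _≈ᴰ_)
  open ℤ-CoefficientSolver R using (solve; _:=_; :0; :1; _:+_; _:*_; _:-_; :-_)
  open import Relation.Binary.Reasoning.Setoid setoid

  signStep : Sign → Carrier
  signStep plus = 1#
  signStep minus = - 1#

  signPow-zero : ∀ s → signPow s 0 ≈ 1#
  signPow-zero plus = refl
  signPow-zero minus = refl

  signPow-suc : ∀ s n → signPow s (suc n) ≈ signStep s * signPow s n
  signPow-suc plus n = sym (*-identityˡ 1#)
  signPow-suc minus n = refl

  -- num and den vanish only at 0 and 1, where t(1 - t) does too; so their derivatives along
  -- t(1 - t) d/dt are num t · numLog t and den t · denLog t, with numLog, denLog polynomial.
  numLog denLog : Möb → Carrier → Carrier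
  numLog idT  t = 1# - t
  numLog invT t = 0#
  numLog oneM t = - t
  numLog mtb  t = 1# - t
  numLog mbt  t = - t
  numLog inv1 t = 0#
  denLog idT  t = 0#
  denLog invT t = 1# - t
  denLog oneM t = 0#
  denLog mtb  t = - t
  denLog mbt  t = 1# - t
  denLog inv1 t = - t

  num-dual : ∀ M t → DualGKP.num M (t , t * (1# - t)) ≈ᴰ (num M t , num M t * numLog M t)
  num-dual idT  t = refl , refl
  num-dual invT t = refl , sym (zeroʳ 1#)
  num-dual oneM t = refl , solve 1 (λ t → :0 :- t :* (:1 :- t) := (:1 :- t) :* (:- t)) refl t
  num-dual mtb  t = refl , solve 1 (λ t → :- (t :* (:1 :- t)) := (:- t) :* (:1 :- t)) refl t
  num-dual mbt  t = refl , solve 1 (λ t → :- (:0 :- t :* (:1 :- t)) := (:- (:1 :- t)) :* (:- t)) refl t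
  num-dual inv1 t = refl , sym (zeroʳ 1#)

  den-dual : ∀ M t → DualGKP.den M (t , t * (1# - t)) ≈ᴰ (den M t , den M t * denLog M t)
  den-dual idT  t = refl , sym (zeroʳ 1#)
  den-dual invT t = refl , refl
  den-dual oneM t = refl , sym (zeroʳ 1#)
  den-dual mtb  t = refl , solve 1 (λ t → :0 :- t :* (:1 :- t) := (:1 :- t) :* (:- t)) refl t
  den-dual mbt  t = refl , refl
  den-dual inv1 t = refl , solve 1 (λ t → :0 :- t :* (:1 :- t) := (:1 :- t) :* (:- t)) refl t

  logDerivative-difference : ∀ M t → signStep (sign M) * (den M t - num M t) ≈ numLog M t - denLog M t
  logDerivative-difference idT  t = solve 1 (λ t → :1 :* (:1 :- t) := (:1 :- t) :- :0) refl t
  logDerivative-difference invT t = solve 1 (λ t → :1 :* (t :- :1) := :0 :- (:1 :- t)) refl t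
  logDerivative-difference oneM t = solve 1 (λ t → (:- :1) :* (:1 :- (:1 :- t)) := (:- t) :- :0) refl t
  logDerivative-difference mtb  t = solve 1 (λ t → :1 :* ((:1 :- t) :- (:- t)) := (:1 :- t) :- (:- t)) refl t
  logDerivative-difference mbt  t = solve 1 (λ t → (:- :1) :* (t :- (:- (:1 :- t))) := (:- t) :- (:1 :- t)) refl t
  logDerivative-difference inv1 t = solve 1 (λ t → (:- :1) :* ((:1 :- t) :- :1) := :0 :- (:- t)) refl t

  permute : Möb → (Pt → Carrier) → Pt → Carrier
  permute M r q = r (act M q)

  coeff₀ coeff∞ : (r g : Pt → Carrier) → ℕ → Carrier
  coeff₀ r g n = - r p0 * nat n + g p0
  coeff∞ r g n = (1# - r p∞) * nat n + g p∞

  private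
    modulo-relations : ∀ {x y ρ γ} u v → ρ ≈ 1# → γ ≈ 0# → x ≈ y + u * (ρ - 1#) + v * γ → x ≈ y
    modulo-relations {x} {y} {ρ} {γ} u v ρ≈1 γ≈0 x≈ = begin
      x                                ≈⟨ x≈ ⟩
      y + u * (ρ - 1#) + v * γ         ≈⟨ +-cong (+-congˡ (*-congˡ (+-congʳ ρ≈1))) (*-congˡ γ≈0) ⟩
      y + u * (1# - 1#) + v * 0#       ≈⟨ solve 3 (λ y u v → y :+ u :* (:1 :- :1) :+ v :* :0 := y) refl y u v ⟩
      y                                ∎

  coefficient-transport : ∀ (r g : Pt → Carrier) → r p0 + r p1 + r p∞ ≈ 1# → g p0 + g p1 + g p∞ ≈ 0# → ∀ M n t →
    signStep (sign M) * (coeff₀ r g n * den M t + coeff∞ r g n * num M t) ≈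
      (coeff₀ (permute M r) (permute M g) n * 1# + coeff∞ (permute M r) (permute M g) n * t) + denLog M t * nat n
  coefficient-transport r g Σr Σg idT n t =
    solve 6 (λ r0 ri g0 gi m t → :1 :* (((:- r0) :* m :+ g0) :* :1 :+ ((:1 :- ri) :* m :+ gi) :* t)
                               := (((:- r0) :* m :+ g0) :* :1 :+ ((:1 :- ri) :* m :+ gi) :* t) :+ :0 :* m)
      refl (r p0) (r p∞) (g p0) (g p∞) (nat n) t
  coefficient-transport r g Σr Σg invT n t =
    solve 6 (λ r0 ri g0 gi m t → :1 :* (((:- r0) :* m :+ g0) :* t :+ ((:1 :- ri) :* m :+ gi) :* :1)
                               := (((:- ri) :* m :+ gi) :* :1 :+ ((:1 :- r0) :* m :+ g0) :* t) :+ (:1 :- t) :* m)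
      refl (r p0) (r p∞) (g p0) (g p∞) (nat n) t
  coefficient-transport r g Σr Σg oneM n t = modulo-relations (nat n) (- 1#) Σr Σg
    (solve 8 (λ r0 r1 ri g0 g1 gi m t →
       (:- :1) :* (((:- r0) :* m :+ g0) :* :1 :+ ((:1 :- ri) :* m :+ gi) :* (:1 :- t))
       := (((:- r1) :* m :+ g1) :* :1 :+ ((:1 :- ri) :* m :+ gi) :* t) :+ :0 :* m
          :+ m :* (r0 :+ r1 :+ ri :- :1) :+ (:- :1) :* (g0 :+ g1 :+ gi))
     refl (r p0) (r p1) (r p∞) (g p0) (g p1) (g p∞) (nat n) t)
  coefficient-transport r g Σr Σg mtb n t = modulo-relations (t * nat n) (- t) Σr Σg
    (solve 8 (λ r0 r1 ri g0 g1 gi m t →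
       :1 :* (((:- r0) :* m :+ g0) :* (:1 :- t) :+ ((:1 :- ri) :* m :+ gi) :* (:- t))
       := (((:- r0) :* m :+ g0) :* :1 :+ ((:1 :- r1) :* m :+ g1) :* t) :+ (:- t) :* m
          :+ (t :* m) :* (r0 :+ r1 :+ ri :- :1) :+ (:- t) :* (g0 :+ g1 :+ gi))
     refl (r p0) (r p1) (r p∞) (g p0) (g p1) (g p∞) (nat n) t)
  coefficient-transport r g Σr Σg mbt n t = modulo-relations (t * nat n) (- t) Σr Σg
    (solve 8 (λ r0 r1 ri g0 g1 gi m t →
       (:- :1) :* (((:- r0) :* m :+ g0) :* t :+ ((:1 :- ri) :* m :+ gi) :* (:- (:1 :- t)))
       := (((:- ri) :* m :+ gi) :* :1 :+ ((:1 :- r1) :* m :+ g1) :* t) :+ (:1 :- t) :* m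
          :+ (t :* m) :* (r0 :+ r1 :+ ri :- :1) :+ (:- t) :* (g0 :+ g1 :+ gi))
     refl (r p0) (r p1) (r p∞) (g p0) (g p1) (g p∞) (nat n) t)
  coefficient-transport r g Σr Σg inv1 n t = modulo-relations (nat n) (- 1#) Σr Σg
    (solve 8 (λ r0 r1 ri g0 g1 gi m t →
       (:- :1) :* (((:- r0) :* m :+ g0) :* (:1 :- t) :+ ((:1 :- ri) :* m :+ gi) :* :1)
       := (((:- r1) :* m :+ g1) :* :1 :+ ((:1 :- r0) :* m :+ g0) :* t) :+ (:- t) :* m
          :+ m :* (r0 :+ r1 :+ ri :- :1) :+ (:- :1) :* (g0 :+ g1 :+ gi))
     refl (r p0) (r p1) (r p∞) (g p0) (g p1) (g p∞) (nat n) t)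

module Transport {c ℓ : Level} where

  Transported : ℕ → Set (lsuc (c ⊔ ℓ))
  Transported n = (R : CommutativeRing c ℓ) →
    let open CommutativeRing R
        open GKP R
        open BinaryForms R
        open Möbius R using (permute)
    in (r g : Pt → Carrier) → r p0 + r p1 + r p∞ ≈ 1# → g p0 + g p1 + g p∞ ≈ 0# →
       (M : Möb) (t : Carrier) →
       transformedRow M r g n t ≈ binaryForm n (Ttab (permute M r) (permute M g) n) t 1#

  module _ (R : CommutativeRing c ℓ) where
    open CommutativeRing R hiding (zero)
    open GKP R
    open BinaryForms R
    open DualNumbers R
    open Möbius R
    open ℤ-CoefficientSolver R using (solve; _:=_; :0; :1; _:+_; _:*_; _:-_; :-_)
    open import Relation.Binary.Reasoning.Setoid setoid

    recurrence-transport : ∀ {σ ε H W H* W* A B A* B* a b m N D t} →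
      ε * H ≈ H* →
      ε * ((a - b) * W + b * m * H) ≈ (1# - t) * W* →
      σ * (A * D + B * N) ≈ (A* * 1# + B* * t) + b * m →
      σ * (D - N) ≈ a - b →
      (σ * ε) * (D * (A * H + 1# * W) + N * (B * H + - 1# * W)) ≈
        1# * (A* * H* + 1# * W*) + t * (B* * H* + - 1# * W*)
    recurrence-transport {σ} {ε} {H} {W} {H*} {W*} {A} {B} {A*} {B*} {a} {b} {m} {N} {D} {t}
                         εH≈ εW≈ σAB≈ σDN≈ = begin
      (σ * ε) * (D * (A * H + 1# * W) + N * (B * H + - 1# * W))
        ≈⟨ solve 8 (λ σ ε h w a b x y → (σ :* ε) :* (y :* (a :* h :+ :1 :* w) :+ x :* (b :* h :+ (:- :1) :* w))
                                       := (σ :* (a :* y :+ b :* x)) :* (ε :* h) :+ (σ :* (y :- x)) :* (ε :* w))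
             refl σ ε H W A B N D ⟩
      (σ * (A * D + B * N)) * (ε * H) + (σ * (D - N)) * (ε * W)
        ≈⟨ +-cong (*-cong σAB≈ εH≈) (*-congʳ σDN≈) ⟩
      ((A* * 1# + B* * t) + b * m) * H* + (a - b) * (ε * W)
        ≈⟨ solve 6 (λ k bm h a b εw → (k :+ bm) :* h :+ (a :- b) :* εw := k :* h :+ (bm :* h :+ (a :- b) :* εw))
             refl (A* * 1# + B* * t) (b * m) H* a b (ε * W) ⟩
      (A* * 1# + B* * t) * H* + (b * m * H* + (a - b) * (ε * W))
        ≈⟨ +-congˡ (+-congʳ (*-congˡ εH≈)) ⟨
      (A* * 1# + B* * t) * H* + (b * m * (ε * H) + (a - b) * (ε * W))
        ≈⟨ +-congˡ (solve 6 (λ b m ε h a w → b :* m :* (ε :* h) :+ (a :- b) :* (ε :* w)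
                                            := ε :* ((a :- b) :* w :+ b :* m :* h))
                      refl b m ε H a W) ⟩
      (A* * 1# + B* * t) * H* + ε * ((a - b) * W + b * m * H)
        ≈⟨ +-congˡ εW≈ ⟩
      (A* * 1# + B* * t) * H* + (1# - t) * W*
        ≈⟨ solve 5 (λ a b t h w → (a :* :1 :+ b :* t) :* h :+ (:1 :- t) :* w
                                 := :1 :* (a :* h :+ :1 :* w) :+ t :* (b :* h :+ (:- :1) :* w))
             refl A* B* t H* W* ⟩
      1# * (A* * H* + 1# * W*) + t * (B* * H* + - 1# * W*) ∎

    transport-derivative : ∀ {n} → Transported n → ∀ (r g : Pt → Carrier) →
      r p0 + r p1 + r p∞ ≈ 1# → g p0 + g p1 + g p∞ ≈ 0# → ∀ M t →
      signPow (sign M) n * ((numLog M t - denLog M t) * eulerForm n (Ttab r g n) (num M t) (den M t)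
                            + denLog M t * nat n * binaryForm n (Ttab r g n) (num M t) (den M t))
        ≈ (1# - t) * eulerForm n (Ttab (permute M r) (permute M g) n) t 1#
    transport-derivative {n} IH r g Σr Σg M t = begin
      signPow (sign M) n * ((numLog M t - denLog M t) * eulerForm n (Ttab r g n) (num M t) (den M t)
                            + denLog M t * nat n * binaryForm n (Ttab r g n) (num M t) (den M t))
        ≈⟨ *-congˡ (proj₂-binaryForm n _ _ _ _ _ (ι-Ttab r g n) (num-dual M t) (den-dual M t)) ⟨
      signPow (sign M) n *
        proj₂ (DualForms.binaryForm n (DualGKP.Ttab ιr ιg n) (DualGKP.num M t̂) (DualGKP.den M t̂))
        ≈⟨ proj₂-ι-* _ (ι-signPow (sign M) n) ⟨
      proj₂ (DualGKP.transformedRow M ιr ιg n t̂)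
        ≈⟨ proj₂ (IH (dualNumbers R) ιr ιg (Σr , 0+0+0≈0) (Σg , 0+0+0≈0) M t̂) ⟩
      proj₂ (DualForms.binaryForm n (DualGKP.Ttab (λ q → ιr (act M q)) (λ q → ιg (act M q)) n) t̂ Dual.1#)
        ≈⟨ proj₂-binaryForm n _ _ _ _ _ (ι-Ttab (permute M r) (permute M g) n)
                            (refl , refl) (refl , sym (zeroʳ 1#)) ⟩
      ((1# - t) - 0#) * W* + 0# * nat n * binaryForm n (Ttab (permute M r) (permute M g) n) t 1#
        ≈⟨ solve 4 (λ t w m h → ((:1 :- t) :- :0) :* w :+ :0 :* m :* h := (:1 :- t) :* w)
             refl t W* (nat n) _ ⟩
      (1# - t) * W* ∎
      where
      ιr ιg : Pt → Dual.Carrier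
      ιr q = ι (r q)
      ιg q = ι (g q)
      t̂ : Dual.Carrier
      t̂ = t , t * (1# - t)
      W* : Carrier
      W* = eulerForm n (Ttab (permute M r) (permute M g) n) t 1#
      0+0+0≈0 : 0# + 0# + 0# ≈ 0#
      0+0+0≈0 = trans (+-identityʳ _) (+-identityʳ 0#)

  transport : ∀ n → Transported n
  transport zero R r g Σr Σg M t = trans (*-congʳ (signPow-zero (sign M))) (*-identityˡ _)
    where
    open CommutativeRing R
    open Möbius R
  transport (suc n) R r g Σr Σg M t = begin
    signPow (sign M) (suc n) * binaryForm (suc n) (Ttab r g (suc n)) (num M t) (den M t)
      ≈⟨ *-cong (signPow-suc (sign M) n) (binaryForm-GKPtri-suc _ _ _ _ _ _ n (num M t) (den M t)) ⟩
    _ ≈⟨ recurrence-transport R (IH R r g Σr Σg M t) (transport-derivative R IH r g Σr Σg M t)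
                                (coefficient-transport r g Σr Σg M n t) (logDerivative-difference M t) ⟩
    _ ≈⟨ binaryForm-GKPtri-suc _ _ _ _ _ _ n t 1# ⟨
    binaryForm (suc n) (Ttab (permute M r) (permute M g) (suc n)) t 1# ∎
    where
    IH : Transported n
    IH = transport n
    open CommutativeRing R hiding (zero)
    open GKP R
    open BinaryForms R
    open Möbius R
    open import Relation.Binary.Reasoning.Setoid setoid

theorem3p1 : ∀ {c ℓ : Level} (Rg : CommutativeRing c ℓ) →
    let open CommutativeRing Rg
        open GKP Rg
    in (r g : Pt → Carrier) →
       r p0 + r p1 + r p∞ ≈ 1# →
       g p0 + g p1 + g p∞ ≈ 0# →
       (M : Möb) (n : ℕ) (t : Carrier) →
       transformedRow M r g n t ≈ rowPoly (λ q → r (act M q)) (λ q → g (act M q)) n t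
theorem3p1 Rg r g Σr Σg M n t =
  trans (Transport.transport n Rg r g Σr Σg M t) (binaryForm-at-1# n _ t)
  where
  open CommutativeRing Rg
  open BinaryForms Rg
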